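{- Let $D\in\mathbb{Z}\setminus\{0,1\}$ be squarefree, $K=\mathbb{Q}(\sqrt{D})$, $p$ a prime dividing $D$, and $G$ an integral, $\mathbb{Z}$-valued generalized quadratic form in $n$ variables over $K$. If $Q$ is the quadratic form associated to $G$ and $M_Q$ is its matrix, then $\operatorname{rank}(M_Q\bmod p)\le n$.
   Context: $\mathcal{O}_K$ is the ring of integers, $\tau: K\to K$, $a+b\sqrt{D}\mapsto a-b\sqrt{D}$; $\omega_D=\sqrt{D}$ if $D\equiv 2,3\pmod 4$, $\omega_D=\frac{1+\sqrt{D}}{2}$ if $D\equiv1\pmod4$. A generalized quadratic form in $n$ variables is $G(z_1,\dots,z_n)=\sum_{1\le i\le j\le n}\alpha_{ij}z_iz_j+\sum_{1\le i,j\le n}\beta_{ij}z_i\tau(z_j)+\sum_{1\le i\le j\le n}\gamma_{ij}\tau(z_i)\tau(z_j)$, evaluated at $\mathbf{a}\in K^n$ by substituting $a_i$, $\tau(a_i)$. Integral: all coefficients in $\mathcal{O}_K$. $\mathbb{Z}$-valued: $G(\mathbf{a})\in\mathbb{Z}$ for all $\mathbf{a}\in\mathcal{O}_K^n$. The associated form is $Q(x_1,y_1,\dots,x_n,y_n)=G(x_1+y_1\omega_D,\dots,x_n+y_n\omega_D)$ and $M_Q$ is its symmetric matrix (diagonal: coefficients of squares; off-diagonal: half the coefficients of cross terms). $M_Q\bmod p$ denotes the entrywise reduction to $\mathbb{Z}/p\mathbb{Z}$ (the entries of $M_Q$ are rationals whose denominators are prime to $p$), and rank is over $\mathbb{Z}/p\mathbb{Z}$.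 -}

module Defs where

open import Data.Nat as ℕ using (ℕ; zero; suc)
open import Data.Integer as ℤ using (ℤ; +_; 0ℤ; 1ℤ)
open import Data.Integer.DivMod using (_%ℕ_) renaming (_/_ to _divℤ_)
open import Data.Integer.Divisibility as ℤd using ()
open import Data.Nat.Divisibility as ℕd using ()
open import Data.Rational.Unnormalised as ℚᵘ using (ℚᵘ; _≃_) renaming (_/_ to _÷_)
open import Data.Fin as Fin using (Fin; zero; suc; toℕ)
open import Data.Fin.Properties as FinP using ()
open import Data.Product using (_×_; _,_; ∃; ∃-syntax; proj₁; proj₂)
open import Data.Product.Properties using (≡-dec)
open import Data.Bool using (Bool; true; false; if_then_else_)
open import Relation.Nullary using (¬_)
open import Relation.Nullary.Decidable using (⌊_⌋)
open import Relation.Binary.PropositionalEquality using (_≡_)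

SquareFree : ℤ → Set
SquareFree D = ∀ (m : ℕ) → (m ℕ.* m) ℕd.∣ ℤ.∣ D ∣ → m ≡ 1

-- O_K = ℤ[ω_D], elements a + b ω_D represented as pairs (a , b).
-- ω_D satisfies ω² = t ω + m and τ(ω) = t − ω, where
--   D ≡ 2,3 (mod 4): ω = √D,          t = 0, m = D
--   D ≡ 1   (mod 4): ω = (1 + √D)/2,  t = 1, m = (D − 1)/4

D≡1mod4 : ℤ → Bool
D≡1mod4 D = (D %ℕ 4) ℕ.≡ᵇ 1

trω : ℤ → ℤ
trω D = if D≡1mod4 D then 1ℤ else 0ℤ

mω : ℤ → ℤ
mω D = if D≡1mod4 D then (D ℤ.- 1ℤ) divℤ (+ 4) else D

record OK : Set where
  constructor _+_ω
  field
    re : ℤ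
    im : ℤ
open OK public

module Arith (D : ℤ) where
  infixl 6 _⊕_ _⊖_
  infixl 7 _⊗_

  _⊕_ : OK → OK → OK
  (a + b ω) ⊕ (c + d ω) = (a ℤ.+ c) + (b ℤ.+ d) ω

  _⊖_ : OK → OK → OK
  (a + b ω) ⊖ (c + d ω) = (a ℤ.- c) + (b ℤ.- d) ω

  _⊗_ : OK → OK → OK
  (a + b ω) ⊗ (c + d ω) =
    (a ℤ.* c ℤ.+ b ℤ.* d ℤ.* mω D) + (a ℤ.* d ℤ.+ b ℤ.* c ℤ.+ b ℤ.* d ℤ.* trω D) ω

  τ : OK → OK
  τ (a + b ω) = (a ℤ.+ b ℤ.* trω D) + (ℤ.- b) ω

  zeroK : OK
  zeroK = 0ℤ + 0ℤ ω

  ΣK : (n : ℕ) → (Fin n → OK) → OK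
  ΣK zero    f = zeroK
  ΣK (suc n) f = f zero ⊕ ΣK n (λ i → f (suc i))


-- Integral generalized quadratic forms in n variables:
-- all coefficients α_ij, β_ij, γ_ij lie in O_K (integrality is built into
-- the representation).  The entries α_ij, γ_ij with i > j are unused.

record GQF (n : ℕ) : Set where
  field
    α β γ : Fin n → Fin n → OK

when≤ : ∀ {n} → Fin n → Fin n → OK → OK
when≤ i j x = if ⌊ i Fin.≤? j ⌋ then x else (0ℤ + 0ℤ ω)

evalG : (D : ℤ) → ∀ {n} → GQF n → (Fin n → OK) → OK
evalG D {n} G a =
      ΣK n (λ i → ΣK n (λ j → when≤ i j (α i j ⊗ a i ⊗ a j)))
    ⊕ ΣK n (λ i → ΣK n (λ j → β i j ⊗ a i ⊗ τ (a j)))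
    ⊕ ΣK n (λ i → ΣK n (λ j → when≤ i j (γ i j ⊗ τ (a i) ⊗ τ (a j))))
  where open GQF G ; open Arith D

ZValued : (D : ℤ) → ∀ {n} → GQF n → Set
ZValued D {n} G = ∀ (a : Fin n → OK) → im (evalG D G a) ≡ 0ℤ

-- The associated form Q(x₁,y₁,…,xₙ,yₙ) = G(x₁ + y₁ω, …, xₙ + yₙω).
-- Variables are indexed by Fin n × Fin 2  ((i , 0) ↦ xᵢ, (i , 1) ↦ yᵢ).

Var : ℕ → Set
Var n = Fin n × Fin 2

evalQ : (D : ℤ) → ∀ {n} → GQF n → (Var n → ℤ) → OK
evalQ D G v = evalG D G (λ i → v (i , zero) + v (i , suc zero) ω)

_==_ : ∀ {n} → Var n → Var n → Bool
k == l = ⌊ ≡-dec Fin._≟_ Fin._≟_ k l ⌋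

𝟙 : Bool → ℤ
𝟙 true  = 1ℤ
𝟙 false = 0ℤ

eᵥ : ∀ {n} → Var n → Var n → ℤ
eᵥ k v = 𝟙 (k == v)

eᵥ₂ : ∀ {n} → Var n → Var n → Var n → ℤ
eᵥ₂ k l v = eᵥ k v ℤ.+ eᵥ l v

sqCoeff : (D : ℤ) → ∀ {n} → GQF n → Var n → ℤ
sqCoeff D G k = re (evalQ D G (eᵥ k))

crossCoeff : (D : ℤ) → ∀ {n} → GQF n → Var n → Var n → ℤ
crossCoeff D G k l =
  re (evalQ D G (eᵥ₂ k l) ⊖ evalQ D G (eᵥ k) ⊖ evalQ D G (eᵥ l))
  where open Arith D

MQ : (D : ℤ) → ∀ {n} → GQF n → Var n → Var n → ℚᵘ
MQ D G k l = if k == l then sqCoeff D G k ÷ 1 else crossCoeff D G k l ÷ 2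

-- the rational q (with denominator prime to p) reduces to 0 in ℤ/pℤ
ZeroModP : ℕ → ℚᵘ → Set
ZeroModP p q = ∃[ a ] ∃[ b ] (¬ ((+ p) ℤd.∣ b) × (+ p) ℤd.∣ a × (q ℚᵘ.* (b ÷ 1)) ≃ (a ÷ 1))

ΣQ : (k : ℕ) → (Fin k → ℚᵘ) → ℚᵘ
ΣQ zero    f = ℚᵘ.0ℚᵘ
ΣQ (suc k) f = f zero ℚᵘ.+ ΣQ k (λ i → f (suc i))

-- the rows f(0),…,f(k−1) of (M mod p) are linearly independent over ℤ/pℤ
-- (coefficients in ℤ/pℤ represented by integer lifts c i)
RowsIndepModP : ℕ → ∀ {I J : Set} → (I → J → ℚᵘ) → ∀ {k} → (Fin k → I) → Set
RowsIndepModP p {I} {J} M {k} f =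
  ∀ (c : Fin k → ℤ) →
    (∀ (j : J) → ZeroModP p (ΣQ k (λ i → (c i ÷ 1) ℚᵘ.* M (f i) j))) →
    ∀ i → (+ p) ℤd.∣ c i

-- rank(M mod p) ≤ r : every linearly independent family of rows of
-- (M mod p) has size ≤ r (rank = maximal number of independent rows)
RankModP≤ : ℕ → ∀ {n} → (Var n → Var n → ℚᵘ) → ℕ → Set
RankModP≤ p {n} M r =
  ∀ (k : ℕ) (f : Fin k → Var n) → RowsIndepModP p M f → k ℕ.≤ r

{-# OPTIONS --safe #-}
-- Let B(a, w) = G(a + w) − G(a) − G(w). Then 2·M_Q is the Gram matrix of the ℤ-bilinear form B in the
-- ℤ-basis eᵢ, ω eᵢ of O_Kⁿ that underlies the variables xᵢ, yᵢ. Summand by summand, B = L + L̄ with L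
-- linear and L̄ τ-semilinear in a, so with L, L̄ evaluated at (eᵢ, w) we get B(eᵢ, w) = L + L̄ and
-- B(ω eᵢ, w) = ω L + τ(ω) L̄, and both are rational integers because G is ℤ-valued. Writing
-- ω² = tω + m and comparing components: if t = 0 (and then m = D), the yᵢ-row of 2·M_Q is 2m·im L;
-- if t = 1 (and then 4m + 1 = D, so p ≠ 2), twice the yᵢ-row minus the xᵢ-row is (4m + 1)·im L.
-- Since p ∣ D, the xᵢ- and yᵢ-rows of M_Q are dependent mod p, so rows that are independent mod p
-- belong to distinct indices i, of which there are n.
module Submission where

open import Defs
open import Algebra.Bundles using (CommutativeSemiring)
open import Algebra.Structures using (IsCommutativeMonoid)
open import Data.Bool using (Bool; true; false; if_then_else_; T)
open import Data.Fin as Fin using (Fin; zero; suc)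
import Data.Fin.Properties as Fin
open import Data.Fin.Patterns using (0F; 1F)
open import Data.Integer using (ℤ; +_; 0ℤ; 1ℤ; -1ℤ; _+_; _*_; _-_; -_)
import Data.Integer.Properties as ℤ
open import Data.Integer.DivMod using (_%ℕ_; _/ℕ_; a≡a%ℕn+[a/ℕn]*n; n%ℕd<d; div-pos-is-/ℕ)
  renaming (_/_ to _divℤ_)
open import Data.Integer.Divisibility using (_∣_)
import Data.Integer.Divisibility.Signed as Signed
open import Data.Integer.Tactic.RingSolver using (solve) renaming (ring to ℤ-ring)
open import Data.List using (_∷_; [])
open import Data.Maybe using (nothing)
open import Data.Nat as ℕ using (ℕ; zero; suc)
import Data.Nat.DivMod as ℕ
import Data.Nat.Divisibility as ℕ
open import Data.Nat.Primality using (Prime; ¬prime[1])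
import Data.Nat.Properties as ℕ
open import Data.Product using (_×_; _,_; proj₁)
open import Data.Product.Properties using (≡-dec)
open import Data.Rational.Unnormalised as ℚᵘ using (ℚᵘ; _≃_; *≡*) renaming (_/_ to _÷_)
open import Data.Rational.Unnormalised.Properties using (≃-reflexive; ≃-trans; +-cong; *-congˡ; *-congʳ)
open import Data.Sum using (_⊎_; inj₁; inj₂)
open import Function using (_⇔_; mk⇔)
open import Level using (0ℓ)
open import Relation.Nullary using (¬_; Dec; does; yes; no; contradiction)
open import Relation.Nullary.Decidable using (⌊_⌋; isYes; isYes≗does; dec-false; does-⇔)
open import Relation.Binary.PropositionalEquality
open import Relation.Binary.PropositionalEquality.Algebra using (isMagma)
open import Algebra.Structures.Biased {A = OK} _≡_ using (isCommutativeMonoidˡ; isCommutativeSemiringˡ)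
open import Algebra.Properties.Semiring.Sum ℤ.+-*-semiring
  using (sum; sum-cong-≗; ∑-distrib-+; *-distribˡ-sum; sum-replicate-zero)
open import Tactic.RingSolver using (solve-∀)
open import Tactic.RingSolver.Core.AlmostCommutativeRing using (AlmostCommutativeRing; fromCommutativeSemiring)

open ≡-Reasoning

-- At t = trω D, m = mω D this is O_K, and the
-- operations coincide definitionally with those of Arith D; t and m are kept abstract so that the
-- ring solvers treat them as variables.
module QuadraticOrder (t m : ℤ) where

  infixl 6 _⊕_ _⊖_
  infixl 7 _⊗_

  _⊕_ : OK → OK → OK
  (a + b ω) ⊕ (c + d ω) = (a + c) + (b + d) ω

  _⊖_ : OK → OK → OK
  (a + b ω) ⊖ (c + d ω) = (a - c) + (b - d) ω

  _⊗_ : OK → OK → OK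
  (a + b ω) ⊗ (c + d ω) = (a * c + b * d * m) + (a * d + b * c + b * d * t) ω

  τ : OK → OK
  τ (a + b ω) = (a + b * t) + (- b) ω

  0̂ 1̂ ω̂ : OK
  0̂ = 0ℤ + 0ℤ ω
  1̂ = 1ℤ + 0ℤ ω
  ω̂ = 0ℤ + 1ℤ ω

  ⊕-assoc : ∀ x y z → x ⊕ y ⊕ z ≡ x ⊕ (y ⊕ z)
  ⊕-assoc (a + b ω) (c + d ω) (e + f ω) = cong₂ _+_ω (ℤ.+-assoc a c e) (ℤ.+-assoc b d f)

  ⊕-comm : ∀ x y → x ⊕ y ≡ y ⊕ x
  ⊕-comm (a + b ω) (c + d ω) = cong₂ _+_ω (ℤ.+-comm a c) (ℤ.+-comm b d)

  ⊕-identityˡ : ∀ x → 0̂ ⊕ x ≡ x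
  ⊕-identityˡ (a + b ω) = cong₂ _+_ω (ℤ.+-identityˡ a) (ℤ.+-identityˡ b)

  ⊗-assoc : ∀ x y z → x ⊗ y ⊗ z ≡ x ⊗ (y ⊗ z)
  ⊗-assoc (a + b ω) (c + d ω) (e + f ω) = cong₂ _+_ω re-assoc im-assoc
    where
    re-assoc : (a * c + b * d * m) * e + (a * d + b * c + b * d * t) * f * m
             ≡ a * (c * e + d * f * m) + b * (c * f + d * e + d * f * t) * m
    re-assoc = solve (a ∷ b ∷ c ∷ d ∷ e ∷ f ∷ t ∷ m ∷ [])
    im-assoc : (a * c + b * d * m) * f + (a * d + b * c + b * d * t) * e + (a * d + b * c + b * d * t) * f * t
             ≡ a * (c * f + d * e + d * f * t) + b * (c * e + d * f * m) + b * (c * f + d * e + d * f * t) * t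
    im-assoc = solve (a ∷ b ∷ c ∷ d ∷ e ∷ f ∷ t ∷ m ∷ [])

  ⊗-comm : ∀ x y → x ⊗ y ≡ y ⊗ x
  ⊗-comm (a + b ω) (c + d ω) = cong₂ _+_ω (solve (a ∷ b ∷ c ∷ d ∷ m ∷ [])) (solve (a ∷ b ∷ c ∷ d ∷ t ∷ []))

  ⊗-identityˡ : ∀ x → 1̂ ⊗ x ≡ x
  ⊗-identityˡ (a + b ω) = cong₂ _+_ω (solve (a ∷ b ∷ m ∷ [])) (solve (a ∷ b ∷ t ∷ []))

  ⊗-zeroˡ : ∀ x → 0̂ ⊗ x ≡ 0̂
  ⊗-zeroˡ (a + b ω) = cong₂ _+_ω (solve (a ∷ b ∷ m ∷ [])) (solve (a ∷ b ∷ t ∷ []))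

  ⊗-distribʳ-⊕ : ∀ x y z → (y ⊕ z) ⊗ x ≡ y ⊗ x ⊕ z ⊗ x
  ⊗-distribʳ-⊕ (a + b ω) (c + d ω) (e + f ω) = cong₂ _+_ω re-distrib im-distrib
    where
    re-distrib : (c + e) * a + (d + f) * b * m ≡ c * a + d * b * m + (e * a + f * b * m)
    re-distrib = solve (a ∷ b ∷ c ∷ d ∷ e ∷ f ∷ m ∷ [])
    im-distrib : (c + e) * b + (d + f) * a + (d + f) * b * t
               ≡ c * b + d * a + d * b * t + (e * b + f * a + f * b * t)
    im-distrib = solve (a ∷ b ∷ c ∷ d ∷ e ∷ f ∷ t ∷ [])

  τ-⊕ : ∀ x y → τ (x ⊕ y) ≡ τ x ⊕ τ y
  τ-⊕ (a + b ω) (c + d ω) = cong₂ _+_ω re-τ (ℤ.neg-distrib-+ b d)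
    where
    re-τ : a + c + (b + d) * t ≡ a + b * t + (c + d * t)
    re-τ = solve (a ∷ b ∷ c ∷ d ∷ t ∷ [])

  τ-⊗ : ∀ x y → τ (x ⊗ y) ≡ τ x ⊗ τ y
  τ-⊗ (a + b ω) (c + d ω) = cong₂ _+_ω re-τ im-τ
    where
    re-τ : a * c + b * d * m + (a * d + b * c + b * d * t) * t ≡ (a + b * t) * (c + d * t) + - b * - d * m
    re-τ = solve (a ∷ b ∷ c ∷ d ∷ t ∷ m ∷ [])
    im-τ : - (a * d + b * c + b * d * t) ≡ (a + b * t) * - d + - b * (c + d * t) + - b * - d * t
    im-τ = solve (a ∷ b ∷ c ∷ d ∷ t ∷ [])

  ℤ[ω] : CommutativeSemiring 0ℓ 0ℓ
  ℤ[ω] = record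
    { Carrier = OK ; _≈_ = _≡_ ; _+_ = _⊕_ ; _*_ = _⊗_ ; 0# = 0̂ ; 1# = 1̂
    ; isCommutativeSemiring = isCommutativeSemiringˡ record
        { +-isCommutativeMonoid = commutativeMonoid _⊕_ 0̂ ⊕-assoc ⊕-identityˡ ⊕-comm
        ; *-isCommutativeMonoid = commutativeMonoid _⊗_ 1̂ ⊗-assoc ⊗-identityˡ ⊗-comm
        ; distribʳ              = ⊗-distribʳ-⊕
        ; zeroˡ                 = ⊗-zeroˡ
        }
    }
    where
    commutativeMonoid : ∀ _∙_ ε → (∀ x y z → (x ∙ y) ∙ z ≡ x ∙ (y ∙ z)) → (∀ x → ε ∙ x ≡ x) →
                        (∀ x y → x ∙ y ≡ y ∙ x) → IsCommutativeMonoid _≡_ _∙_ ε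
    commutativeMonoid _∙_ ε assoc identityˡ comm = isCommutativeMonoidˡ record
      { isSemigroup = record { isMagma = isMagma _∙_ ; assoc = assoc } ; identityˡ = identityˡ ; comm = comm }

  ℤ[ω]-ring : AlmostCommutativeRing 0ℓ 0ℓ
  ℤ[ω]-ring = fromCommutativeSemiring ℤ[ω] (λ _ → nothing)

  open CommutativeSemiring ℤ[ω] public using () renaming (distribˡ to ⊗-distribˡ-⊕; zeroʳ to ⊗-zeroʳ)

  ⊕-interchange : ∀ a b c d → (a ⊕ b) ⊕ (c ⊕ d) ≡ (a ⊕ c) ⊕ (b ⊕ d)
  ⊕-interchange = solve-∀ ℤ[ω]-ring

  re-⊖-cancel : ∀ x y z → re (x ⊕ y ⊕ z ⊖ x ⊖ y) ≡ re z
  re-⊖-cancel (a + _ ω) (b + _ ω) (c + _ ω) = cancel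
    where
    cancel : a + b + c - a - b ≡ c
    cancel = solve (a ∷ b ∷ c ∷ [])

  if-⊗ : ∀ (b : Bool) A x y → (if b then A ⊗ x ⊗ y else 0̂) ≡ (if b then A else 0̂) ⊗ x ⊗ y
  if-⊗ true  A x y = refl
  if-⊗ false A x y = sym (trans (cong (_⊗ y) (⊗-zeroˡ x)) (⊗-zeroˡ y))

  summand : (A B C x y : OK) → OK
  summand A B C x y = A ⊗ x ⊗ y ⊕ B ⊗ x ⊗ τ y ⊕ C ⊗ τ x ⊗ τ y

  -- The cross terms of summand A B C at (x ⊕ w, y ⊕ z): the part linear in (x, y) and the part
  -- τ-semilinear in (x, y).
  linearTerm : (A B x y w z : OK) → OK
  linearTerm A B x y w z = A ⊗ x ⊗ z ⊕ A ⊗ w ⊗ y ⊕ B ⊗ x ⊗ τ z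

  conjugateTerm : (B C x y w z : OK) → OK
  conjugateTerm B C x y w z = B ⊗ w ⊗ τ y ⊕ C ⊗ τ x ⊗ τ z ⊕ C ⊗ τ w ⊗ τ y

  -- τ is not a ring operation, so conjugates enter the identities below as further variables.
  summand-polarise : ∀ A B C x y w z →
    summand A B C (x ⊕ w) (y ⊕ z) ≡
    summand A B C x y ⊕ summand A B C w z ⊕ (linearTerm A B x y w z ⊕ conjugateTerm B C x y w z)
  summand-polarise A B C x y w z =
    trans (cong₂ (λ u v → A ⊗ (x ⊕ w) ⊗ (y ⊕ z) ⊕ B ⊗ (x ⊕ w) ⊗ v ⊕ C ⊗ u ⊗ v) (τ-⊕ x w) (τ-⊕ y z))
          (expand A B C x y w z (τ x) (τ y) (τ w) (τ z))
    where
    expand : ∀ A B C x y w z x̄ ȳ w̄ z̄ →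
      A ⊗ (x ⊕ w) ⊗ (y ⊕ z) ⊕ B ⊗ (x ⊕ w) ⊗ (ȳ ⊕ z̄) ⊕ C ⊗ (x̄ ⊕ w̄) ⊗ (ȳ ⊕ z̄) ≡
      (A ⊗ x ⊗ y ⊕ B ⊗ x ⊗ ȳ ⊕ C ⊗ x̄ ⊗ ȳ) ⊕ (A ⊗ w ⊗ z ⊕ B ⊗ w ⊗ z̄ ⊕ C ⊗ w̄ ⊗ z̄) ⊕
      ((A ⊗ x ⊗ z ⊕ A ⊗ w ⊗ y ⊕ B ⊗ x ⊗ z̄) ⊕ (B ⊗ w ⊗ ȳ ⊕ C ⊗ x̄ ⊗ z̄ ⊕ C ⊗ w̄ ⊗ ȳ))
    expand = solve-∀ ℤ[ω]-ring

  summand-diagonal : ∀ A B C x y →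
    linearTerm A B x y x y ⊕ conjugateTerm B C x y x y ≡ summand A B C x y ⊕ summand A B C x y
  summand-diagonal A B C x y = regroup A B C x y (τ x) (τ y)
    where
    regroup : ∀ A B C x y x̄ ȳ →
      (A ⊗ x ⊗ y ⊕ A ⊗ x ⊗ y ⊕ B ⊗ x ⊗ ȳ) ⊕ (B ⊗ x ⊗ ȳ ⊕ C ⊗ x̄ ⊗ ȳ ⊕ C ⊗ x̄ ⊗ ȳ) ≡
      (A ⊗ x ⊗ y ⊕ B ⊗ x ⊗ ȳ ⊕ C ⊗ x̄ ⊗ ȳ) ⊕ (A ⊗ x ⊗ y ⊕ B ⊗ x ⊗ ȳ ⊕ C ⊗ x̄ ⊗ ȳ)
    regroup = solve-∀ ℤ[ω]-ring

  linearTerm-scale : ∀ A B s x y w z → linearTerm A B (s ⊗ x) (s ⊗ y) w z ≡ s ⊗ linearTerm A B x y w z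
  linearTerm-scale A B s x y w z = factor A B s x y w z (τ z)
    where
    factor : ∀ A B s x y w z z̄ →
      A ⊗ (s ⊗ x) ⊗ z ⊕ A ⊗ w ⊗ (s ⊗ y) ⊕ B ⊗ (s ⊗ x) ⊗ z̄ ≡
      s ⊗ (A ⊗ x ⊗ z ⊕ A ⊗ w ⊗ y ⊕ B ⊗ x ⊗ z̄)
    factor = solve-∀ ℤ[ω]-ring

  conjugateTerm-scale : ∀ B C s x y w z →
    conjugateTerm B C (s ⊗ x) (s ⊗ y) w z ≡ τ s ⊗ conjugateTerm B C x y w z
  conjugateTerm-scale B C s x y w z =
    trans (cong₂ (λ u v → B ⊗ w ⊗ v ⊕ C ⊗ u ⊗ τ z ⊕ C ⊗ τ w ⊗ v) (τ-⊗ s x) (τ-⊗ s y))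
          (factor B C (τ s) (τ x) (τ y) w (τ w) (τ z))
    where
    factor : ∀ B C s̄ x̄ ȳ w w̄ z̄ →
      B ⊗ w ⊗ (s̄ ⊗ ȳ) ⊕ C ⊗ (s̄ ⊗ x̄) ⊗ z̄ ⊕ C ⊗ w̄ ⊗ (s̄ ⊗ ȳ) ≡
      s̄ ⊗ (B ⊗ w ⊗ ȳ ⊕ C ⊗ x̄ ⊗ z̄ ⊕ C ⊗ w̄ ⊗ ȳ)
    factor = solve-∀ ℤ[ω]-ring

  ω̂-⊗-ℤ : ∀ d → ω̂ ⊗ (d + 0ℤ ω) ≡ 0ℤ + d ω
  ω̂-⊗-ℤ d = cong₂ _+_ω (solve (d ∷ m ∷ [])) (solve (d ∷ t ∷ []))

  ω̂-⊗ : ∀ u₀ u₁ → ω̂ ⊗ (u₀ + u₁ ω) ≡ (m * u₁) + (u₀ + t * u₁) ω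
  ω̂-⊗ u₀ u₁ = cong₂ _+_ω (solve (u₀ ∷ u₁ ∷ m ∷ [])) (solve (u₀ ∷ u₁ ∷ t ∷ []))

  τω̂-⊗ : ∀ v₀ v₁ → τ ω̂ ⊗ (v₀ + v₁ ω) ≡ (t * v₀ - m * v₁) + (- v₀) ω
  τω̂-⊗ v₀ v₁ = trans (cong (_⊗ (v₀ + v₁ ω)) τω̂)
                     (cong₂ _+_ω (solve (v₀ ∷ v₁ ∷ t ∷ m ∷ [])) (solve (v₀ ∷ v₁ ∷ t ∷ [])))
    where
    τω̂ : τ ω̂ ≡ t + (- 1ℤ) ω
    τω̂ = cong (_+ (- 1ℤ) ω) (solve (t ∷ []))

  ω-twist : ∀ u₀ u₁ v₀ v₁ →
    ω̂ ⊗ (u₀ + u₁ ω) ⊕ τ ω̂ ⊗ (v₀ + v₁ ω) ≡ (m * u₁ + (t * v₀ - m * v₁)) + (u₀ + t * u₁ + - v₀) ω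
  ω-twist u₀ u₁ v₀ v₁ = cong₂ _⊕_ (ω̂-⊗ u₀ u₁) (τω̂-⊗ v₀ v₁)

  ω-twist-root : t ≡ 0ℤ → ∀ U V → im (U ⊕ V) ≡ 0ℤ → re (ω̂ ⊗ U ⊕ τ ω̂ ⊗ V) ≡ + 2 * (m * im U)
  ω-twist-root t≡0 (u₀ + u₁ ω) (v₀ + v₁ ω) real = begin
    re (ω̂ ⊗ (u₀ + u₁ ω) ⊕ τ ω̂ ⊗ (v₀ + v₁ ω))   ≡⟨ cong re (ω-twist u₀ u₁ v₀ v₁) ⟩
    m * u₁ + (t * v₀ - m * v₁)                  ≡⟨ solve (u₁ ∷ v₀ ∷ v₁ ∷ t ∷ m ∷ []) ⟩
    + 2 * (m * u₁) - m * (u₁ + v₁) + t * v₀     ≡⟨ cong₂ (λ r s → + 2 * (m * u₁) - m * r + s * v₀) real t≡0 ⟩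
    + 2 * (m * u₁) - m * 0ℤ + 0ℤ * v₀           ≡⟨ solve (u₁ ∷ v₀ ∷ m ∷ []) ⟩
    + 2 * (m * u₁)                              ∎

  ω-twist-half : t ≡ 1ℤ → ∀ U V → im (U ⊕ V) ≡ 0ℤ → im (ω̂ ⊗ U ⊕ τ ω̂ ⊗ V) ≡ 0ℤ →
    + 2 * re (ω̂ ⊗ U ⊕ τ ω̂ ⊗ V) - re (U ⊕ V) ≡ (+ 4 * m + 1ℤ) * im U
  ω-twist-half t≡1 (u₀ + u₁ ω) (v₀ + v₁ ω) real real′ = begin
    + 2 * re (ω̂ ⊗ (u₀ + u₁ ω) ⊕ τ ω̂ ⊗ (v₀ + v₁ ω)) - (u₀ + v₀)
      ≡⟨ cong (λ W → + 2 * re W - (u₀ + v₀)) (ω-twist u₀ u₁ v₀ v₁) ⟩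
    + 2 * (m * u₁ + (t * v₀ - m * v₁)) - (u₀ + v₀)
      ≡⟨ solve (u₀ ∷ u₁ ∷ v₀ ∷ v₁ ∷ t ∷ m ∷ []) ⟩
    (+ 4 * m + 1ℤ) * u₁ - + 2 * m * (u₁ + v₁) - (u₀ + t * u₁ + - v₀) + (t - 1ℤ) * (+ 2 * v₀ + u₁)
      ≡⟨ cong₂ (λ r r′ → (+ 4 * m + 1ℤ) * u₁ - + 2 * m * r - r′ + (t - 1ℤ) * (+ 2 * v₀ + u₁))
               real real″ ⟩
    (+ 4 * m + 1ℤ) * u₁ - + 2 * m * 0ℤ - 0ℤ + (t - 1ℤ) * (+ 2 * v₀ + u₁)
      ≡⟨ cong (λ s → (+ 4 * m + 1ℤ) * u₁ - + 2 * m * 0ℤ - 0ℤ + (s - 1ℤ) * (+ 2 * v₀ + u₁))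
              t≡1 ⟩
    (+ 4 * m + 1ℤ) * u₁ - + 2 * m * 0ℤ - 0ℤ + (1ℤ - 1ℤ) * (+ 2 * v₀ + u₁)
      ≡⟨ solve (u₁ ∷ v₀ ∷ m ∷ []) ⟩
    (+ 4 * m + 1ℤ) * u₁ ∎
    where
    real″ : u₀ + t * u₁ + - v₀ ≡ 0ℤ
    real″ = trans (sym (cong im (ω-twist u₀ u₁ v₀ v₁))) real′

module _ {n : ℕ} where
  private
    _≟ᵥ_ : (k l : Var n) → Dec (k ≡ l)
    _≟ᵥ_ = ≡-dec Fin._≟_ Fin._≟_

  eᵥ-≢ : ∀ {k l : Var n} → k ≢ l → eᵥ k l ≡ 0ℤ
  eᵥ-≢ {k} {l} k≢l = cong 𝟙 (trans (isYes≗does (k ≟ᵥ l)) (dec-false (k ≟ᵥ l) k≢l))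

  eᵥ-⇔ : ∀ {k l k′ l′ : Var n} → (k ≡ l ⇔ k′ ≡ l′) → eᵥ k l ≡ eᵥ k′ l′
  eᵥ-⇔ {k} {l} {k′} {l′} k≡l⇔k′≡l′ = cong 𝟙 (begin
    isYes (k ≟ᵥ l)    ≡⟨ isYes≗does (k ≟ᵥ l) ⟩
    does (k ≟ᵥ l)     ≡⟨ does-⇔ k≡l⇔k′≡l′ (k ≟ᵥ l) (k′ ≟ᵥ l′) ⟩
    does (k′ ≟ᵥ l′)   ≡⟨ isYes≗does (k′ ≟ᵥ l′) ⟨
    isYes (k′ ≟ᵥ l′)  ∎)

module Forms (D : ℤ) where
  open QuadraticOrder (trω D) (mω D)
  open Arith D using (ΣK)

  ΣK-cong : ∀ n {f g : Fin n → OK} → (∀ i → f i ≡ g i) → ΣK n f ≡ ΣK n g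
  ΣK-cong zero    f≗g = refl
  ΣK-cong (suc n) f≗g = cong₂ _⊕_ (f≗g zero) (ΣK-cong n (λ i → f≗g (suc i)))

  ΣK-⊕ : ∀ n (f g : Fin n → OK) → ΣK n (λ i → f i ⊕ g i) ≡ ΣK n f ⊕ ΣK n g
  ΣK-⊕ zero    f g = refl
  ΣK-⊕ (suc n) f g = trans (cong (f zero ⊕ g zero ⊕_) (ΣK-⊕ n (λ i → f (suc i)) (λ i → g (suc i))))
                           (⊕-interchange (f zero) (g zero) _ _)

  ΣK-⊗ : ∀ n s (f : Fin n → OK) → ΣK n (λ i → s ⊗ f i) ≡ s ⊗ ΣK n f
  ΣK-⊗ zero    s f = sym (⊗-zeroʳ s)
  ΣK-⊗ (suc n) s f = trans (cong (s ⊗ f zero ⊕_) (ΣK-⊗ n s (λ i → f (suc i))))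
                           (sym (⊗-distribˡ-⊕ s (f zero) _))

  ΣΣ : ∀ n → (Fin n → Fin n → OK) → OK
  ΣΣ n F = ΣK n (λ i → ΣK n (F i))

  ΣΣ-cong : ∀ n {F H : Fin n → Fin n → OK} → (∀ i j → F i j ≡ H i j) → ΣΣ n F ≡ ΣΣ n H
  ΣΣ-cong n F≗H = ΣK-cong n (λ i → ΣK-cong n (F≗H i))

  ΣΣ-⊕ : ∀ n (F H : Fin n → Fin n → OK) → ΣΣ n (λ i j → F i j ⊕ H i j) ≡ ΣΣ n F ⊕ ΣΣ n H
  ΣΣ-⊕ n F H = trans (ΣK-cong n (λ i → ΣK-⊕ n (F i) (H i))) (ΣK-⊕ n _ _)

  ΣΣ-⊗ : ∀ n s (F : Fin n → Fin n → OK) → ΣΣ n (λ i j → s ⊗ F i j) ≡ s ⊗ ΣΣ n F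
  ΣΣ-⊗ n s F = trans (ΣK-cong n (λ i → ΣK-⊗ n s (F i))) (ΣK-⊗ n s _)

  module Polarisation {n} (G : GQF n) where
    open GQF G

    α≤ γ≤ : Fin n → Fin n → OK
    α≤ i j = when≤ i j (α i j)
    γ≤ i j = when≤ i j (γ i j)

    value : (Fin n → OK) → OK
    value a = ΣΣ n (λ i j → summand (α≤ i j) (β i j) (γ≤ i j) (a i) (a j))

    linearPart conjugatePart polar : (Fin n → OK) → (Fin n → OK) → OK
    linearPart    a w = ΣΣ n (λ i j → linearTerm (α≤ i j) (β i j) (a i) (a j) (w i) (w j))
    conjugatePart a w = ΣΣ n (λ i j → conjugateTerm (β i j) (γ≤ i j) (a i) (a j) (w i) (w j))
    polar         a w = linearPart a w ⊕ conjugatePart a w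

    evalG≡value : ∀ a → evalG D G a ≡ value a
    evalG≡value a = sym (begin
      value a
        ≡⟨ ΣΣ-⊕ n _ _ ⟩
      ΣΣ n (λ i j → Aterm i j ⊕ Bterm i j) ⊕ ΣΣ n Cterm
        ≡⟨ cong (_⊕ ΣΣ n Cterm) (ΣΣ-⊕ n Aterm Bterm) ⟩
      ΣΣ n Aterm ⊕ ΣΣ n Bterm ⊕ ΣΣ n Cterm
        ≡⟨ cong₂ (λ A C → A ⊕ ΣΣ n Bterm ⊕ C)
                 (ΣΣ-cong n (λ i j → sym (if-⊗ ⌊ i Fin.≤? j ⌋ (α i j) (a i) (a j))))
                 (ΣΣ-cong n (λ i j → sym (if-⊗ ⌊ i Fin.≤? j ⌋ (γ i j) (τ (a i)) (τ (a j))))) ⟩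
      evalG D G a ∎)
      where
      Aterm Bterm Cterm : Fin n → Fin n → OK
      Aterm i j = α≤ i j ⊗ a i ⊗ a j
      Bterm i j = β i j ⊗ a i ⊗ τ (a j)
      Cterm i j = γ≤ i j ⊗ τ (a i) ⊗ τ (a j)

    value-polarise : ∀ a w → value (λ i → a i ⊕ w i) ≡ value a ⊕ value w ⊕ polar a w
    value-polarise a w = begin
      value (λ i → a i ⊕ w i)
        ≡⟨ ΣΣ-cong n (λ i j → summand-polarise (α≤ i j) (β i j) (γ≤ i j) (a i) (a j) (w i) (w j)) ⟩
      ΣΣ n (λ i j → S a i j ⊕ S w i j ⊕ (L i j ⊕ C i j))
        ≡⟨ ΣΣ-⊕ n _ _ ⟩
      ΣΣ n (λ i j → S a i j ⊕ S w i j) ⊕ ΣΣ n (λ i j → L i j ⊕ C i j)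
        ≡⟨ cong₂ _⊕_ (ΣΣ-⊕ n (S a) (S w)) (ΣΣ-⊕ n L C) ⟩
      value a ⊕ value w ⊕ polar a w ∎
      where
      S : (Fin n → OK) → Fin n → Fin n → OK
      S a i j = summand (α≤ i j) (β i j) (γ≤ i j) (a i) (a j)
      L C : Fin n → Fin n → OK
      L i j = linearTerm (α≤ i j) (β i j) (a i) (a j) (w i) (w j)
      C i j = conjugateTerm (β i j) (γ≤ i j) (a i) (a j) (w i) (w j)

    polar-diagonal : ∀ a → polar a a ≡ value a ⊕ value a
    polar-diagonal a = trans (sym (ΣΣ-⊕ n _ _))
      (trans (ΣΣ-cong n (λ i j → summand-diagonal (α≤ i j) (β i j) (γ≤ i j) (a i) (a j))) (ΣΣ-⊕ n _ _))

    linearPart-scale : ∀ s a {a′} → (∀ i → a′ i ≡ s ⊗ a i) → ∀ w →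
      linearPart a′ w ≡ s ⊗ linearPart a w
    linearPart-scale s a a′≗sa w = trans
      (ΣΣ-cong n λ i j → trans
        (cong₂ (λ x y → linearTerm (α≤ i j) (β i j) x y (w i) (w j)) (a′≗sa i) (a′≗sa j))
        (linearTerm-scale (α≤ i j) (β i j) s (a i) (a j) (w i) (w j)))
      (ΣΣ-⊗ n s _)

    conjugatePart-scale : ∀ s a {a′} → (∀ i → a′ i ≡ s ⊗ a i) → ∀ w →
      conjugatePart a′ w ≡ τ s ⊗ conjugatePart a w
    conjugatePart-scale s a a′≗sa w = trans
      (ΣΣ-cong n λ i j → trans
        (cong₂ (λ x y → conjugateTerm (β i j) (γ≤ i j) x y (w i) (w j)) (a′≗sa i) (a′≗sa j))
        (conjugateTerm-scale (β i j) (γ≤ i j) s (a i) (a j) (w i) (w j)))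
      (ΣΣ-⊗ n (τ s) _)

    polar-real : ZValued D G → ∀ a w → im (polar a w) ≡ 0ℤ
    polar-real G-ℤ a w = begin
      im (polar a w)                                   ≡⟨ sym (ℤ.+-identityˡ _) ⟩
      0ℤ + 0ℤ + im (polar a w)                         ≡⟨ cong₂ (λ x y → x + y + im (polar a w)) (real a) (real w) ⟨
      im (value a) + im (value w) + im (polar a w)     ≡⟨ cong im (value-polarise a w) ⟨
      im (value (λ i → a i ⊕ w i))                     ≡⟨ real (λ i → a i ⊕ w i) ⟩
      0ℤ ∎
      where
      real : ∀ a → im (value a) ≡ 0ℤ
      real a = trans (cong im (sym (evalG≡value a))) (G-ℤ a)

    -- The image of the k-th unit vector under (xᵢ , yᵢ) ↦ xᵢ + yᵢ ω, so that evalQ D G (eᵥ k) is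
    -- evalG D G (basis k).
    basis : Var n → Fin n → OK
    basis k i = eᵥ k (i , 0F) + eᵥ k (i , 1F) ω

    twiceMQ : Var n → Var n → ℤ
    twiceMQ k l = re (polar (basis k) (basis l))

    crossCoeff≡twiceMQ : ∀ k l → crossCoeff D G k l ≡ twiceMQ k l
    crossCoeff≡twiceMQ k l = trans
      (cong re (cong₂ _⊖_ (cong₂ _⊖_ (trans (evalG≡value (λ i → a i ⊕ w i)) (value-polarise a w))
                                     (evalG≡value a))
                          (evalG≡value w)))
      (re-⊖-cancel (value a) (value w) (polar a w))
      where
      a w : Fin n → OK
      a = basis k
      w = basis l

    twice-sqCoeff≡twiceMQ : ∀ k → sqCoeff D G k + sqCoeff D G k ≡ twiceMQ k k
    twice-sqCoeff≡twiceMQ k = cong re (begin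
      evalG D G (basis k) ⊕ evalG D G (basis k) ≡⟨ cong₂ _⊕_ (evalG≡value (basis k)) (evalG≡value (basis k)) ⟩
      value (basis k) ⊕ value (basis k)         ≡⟨ polar-diagonal (basis k) ⟨
      polar (basis k) (basis k)                 ∎)

    MQ≃twiceMQ/2 : ∀ k l → MQ D G k l ≃ (twiceMQ k l ÷ 2)
    MQ≃twiceMQ/2 k l with ≡-dec Fin._≟_ Fin._≟_ k l
    ... | yes refl = *≡* (trans (double (sqCoeff D G k)) (cong (_* + 1) (twice-sqCoeff≡twiceMQ k)))
      where
      double : ∀ x → x * + 2 ≡ (x + x) * + 1
      double = solve-∀ ℤ-ring
    ... | no _     = ≃-reflexive (cong (_÷ 2) (crossCoeff≡twiceMQ k l))

    basis-y : ∀ i j → basis (i , 1F) j ≡ ω̂ ⊗ basis (i , 0F) j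
    basis-y i j = begin
      eᵥ (i , 1F) (j , 0F) + eᵥ (i , 1F) (j , 1F) ω
        ≡⟨ cong₂ _+_ω (eᵥ-≢ {k = i , 1F} {l = j , 0F} λ ()) same-index ⟩
      0ℤ + eᵥ (i , 0F) (j , 0F) ω
        ≡⟨ ω̂-⊗-ℤ (eᵥ (i , 0F) (j , 0F)) ⟨
      ω̂ ⊗ (eᵥ (i , 0F) (j , 0F) + 0ℤ ω)
        ≡⟨ cong (λ d → ω̂ ⊗ (eᵥ (i , 0F) (j , 0F) + d ω)) (eᵥ-≢ {k = i , 0F} {l = j , 1F} λ ()) ⟨
      ω̂ ⊗ basis (i , 0F) j ∎
      where
      same-index : eᵥ (i , 1F) (j , 1F) ≡ eᵥ (i , 0F) (j , 0F)
      same-index = eᵥ-⇔ (mk⇔ (λ { refl → refl }) (λ { refl → refl }))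

    polar-y : ∀ i w → polar (basis (i , 1F)) w ≡
      ω̂ ⊗ linearPart (basis (i , 0F)) w ⊕ τ ω̂ ⊗ conjugatePart (basis (i , 0F)) w
    polar-y i w = cong₂ _⊕_ (linearPart-scale ω̂ (basis (i , 0F)) (basis-y i) w)
                            (conjugatePart-scale ω̂ (basis (i , 0F)) (basis-y i) w)

    module _ (G-ℤ : ZValued D G) (i : Fin n) (l : Var n) where
      private
        U V : OK
        U = linearPart (basis (i , 0F)) (basis l)
        V = conjugatePart (basis (i , 0F)) (basis l)

        polar-y-real : im (ω̂ ⊗ U ⊕ τ ω̂ ⊗ V) ≡ 0ℤ
        polar-y-real = trans (cong im (sym (polar-y i (basis l)))) (polar-real G-ℤ _ _)

      twiceMQ-y-root : trω D ≡ 0ℤ → twiceMQ (i , 1F) l ≡ + 2 * (mω D * im U)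
      twiceMQ-y-root t≡0 = trans (cong re (polar-y i (basis l))) (ω-twist-root t≡0 U V (polar-real G-ℤ _ _))

      twiceMQ-y-half : trω D ≡ 1ℤ → + 2 * twiceMQ (i , 1F) l - twiceMQ (i , 0F) l ≡ (+ 4 * mω D + 1ℤ) * im U
      twiceMQ-y-half t≡1 = trans (cong (λ x → + 2 * re x - twiceMQ (i , 0F) l) (polar-y i (basis l)))
                                 (ω-twist-half t≡1 U V (polar-real G-ℤ _ _) polar-y-real)

prime⇒∤1 : ∀ {p} → Prime p → ¬ (+ p ∣ 1ℤ)
prime⇒∤1 p-prime p∣1 = ¬prime[1] (subst Prime (ℕ.∣1⇒≡1 p∣1) p-prime)

zeroModP-cong : ∀ {p q q′} → q ≃ q′ → ZeroModP p q′ → ZeroModP p q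
zeroModP-cong q≃q′ (a , b , p∤b , p∣a , q′b≃a) = a , b , p∤b , p∣a , ≃-trans (*-congʳ q≃q′) q′b≃a

zeroModP-half-of-double : ∀ {p} → Prime p → ∀ {v} x → + p ∣ x → v ≡ + 2 * x → ZeroModP p (v ÷ 2)
zeroModP-half-of-double p-prime x p∣x refl =
  x , 1ℤ , prime⇒∤1 p-prime , p∣x , *≡* halve
  where
  halve : + 2 * x * 1ℤ * + 1 ≡ x * + 2
  halve = solve (x ∷ [])

zeroModP-half : ∀ {p} → ¬ (+ p ∣ + 2) → ∀ {v} x → + p ∣ x → v ≡ x → ZeroModP p (v ÷ 2)
zeroModP-half p∤2 x p∣x refl = x , + 2 , p∤2 , p∣x , *≡* (ℤ.*-identityʳ (x * + 2))

δ : ∀ {K} → Fin K → Fin K → ℤ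
δ zero    zero    = 1ℤ
δ zero    (suc _) = 0ℤ
δ (suc _) zero    = 0ℤ
δ (suc a) (suc i) = δ a i

δ-diagonal : ∀ {K} (a : Fin K) → δ a a ≡ 1ℤ
δ-diagonal zero    = refl
δ-diagonal (suc a) = δ-diagonal a

δ-≢ : ∀ {K} {a b : Fin K} → a ≢ b → δ a b ≡ 0ℤ
δ-≢ {a = zero}  {zero}  a≢b = contradiction refl a≢b
δ-≢ {a = zero}  {suc b} a≢b = refl
δ-≢ {a = suc a} {zero}  a≢b = refl
δ-≢ {a = suc a} {suc b} a≢b = δ-≢ (λ a≡b → a≢b (cong suc a≡b))

sum-δ : ∀ {K} (a : Fin K) (g : Fin K → ℤ) → sum (λ i → δ a i * g i) ≡ g a
sum-δ {suc K} zero    g = begin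
  1ℤ * g zero + sum (λ i → 0ℤ * g (suc i)) ≡⟨ cong (λ s → 1ℤ * g zero + s) sum-zeros ⟩
  1ℤ * g zero + 0ℤ                         ≡⟨ ℤ.+-identityʳ _ ⟩
  1ℤ * g zero                              ≡⟨ ℤ.*-identityˡ _ ⟩
  g zero                                   ∎
  where
  sum-zeros : sum (λ i → 0ℤ * g (suc i)) ≡ 0ℤ
  sum-zeros = trans (sum-cong-≗ (λ i → ℤ.*-zeroˡ (g (suc i)))) (sum-replicate-zero K)
sum-δ (suc a) g = trans (ℤ.+-identityˡ _) (sum-δ a (λ i → g (suc i)))

sum-pair : ∀ {K} (a b : Fin K) c₁ c₂ (g : Fin K → ℤ) →
  sum (λ i → (c₁ * δ a i + c₂ * δ b i) * g i) ≡ c₁ * g a + c₂ * g b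
sum-pair a b c₁ c₂ g = begin
  sum (λ i → (c₁ * δ a i + c₂ * δ b i) * g i)
    ≡⟨ sum-cong-≗ (λ i → distrib (δ a i) (δ b i) (g i)) ⟩
  sum (λ i → c₁ * (δ a i * g i) + c₂ * (δ b i * g i))
    ≡⟨ ∑-distrib-+ (λ i → c₁ * (δ a i * g i)) (λ i → c₂ * (δ b i * g i)) ⟩
  sum (λ i → c₁ * (δ a i * g i)) + sum (λ i → c₂ * (δ b i * g i))
    ≡⟨ cong₂ _+_ (*-distribˡ-sum c₁ (λ i → δ a i * g i)) (*-distribˡ-sum c₂ (λ i → δ b i * g i)) ⟨
  c₁ * sum (λ i → δ a i * g i) + c₂ * sum (λ i → δ b i * g i)
    ≡⟨ cong₂ (λ x y → c₁ * x + c₂ * y) (sum-δ a g) (sum-δ b g) ⟩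
  c₁ * g a + c₂ * g b ∎
  where
  distrib : ∀ x y z → (c₁ * x + c₂ * y) * z ≡ c₁ * (x * z) + c₂ * (y * z)
  distrib x y z = solve (c₁ ∷ c₂ ∷ x ∷ y ∷ z ∷ [])

half-+ : ∀ x y s → (x ÷ 1) ℚᵘ.* (y ÷ 2) ℚᵘ.+ (s ÷ 2) ≃ ((x * y + s) ÷ 2)
half-+ x y s = *≡* common-denominator
  where
  common-denominator : (x * y * + 2 + s * + 2) * + 2 ≡ (x * y + s) * + 4
  common-denominator = solve (x ∷ y ∷ s ∷ [])

module RowDependence (p : ℕ) {I J : Set} (M : I → J → ℚᵘ) (N : I → J → ℤ)
                     (M≃N/2 : ∀ k l → M k l ≃ (N k l ÷ 2)) where

  combination≃ : ∀ {K} (f : Fin K → I) (c : Fin K → ℤ) j →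
    ΣQ K (λ i → (c i ÷ 1) ℚᵘ.* M (f i) j) ≃ (sum (λ i → c i * N (f i) j) ÷ 2)
  combination≃ {zero}  f c j = *≡* refl
  combination≃ {suc K} f c j = ≃-trans
    (+-cong (*-congˡ {c zero ÷ 1} (M≃N/2 (f zero) j)) (combination≃ (λ i → f (suc i)) (λ i → c (suc i)) j))
    (half-+ (c zero) (N (f zero) j) _)

  pair-dependent : ∀ {K} (f : Fin K → I) {a b : Fin K} → a ≢ b → ∀ c₁ c₂ → ¬ (+ p ∣ c₁) →
    (∀ j → ZeroModP p ((c₁ * N (f a) j + c₂ * N (f b) j) ÷ 2)) → ¬ RowsIndepModP p M f
  pair-dependent {K} f {a} {b} a≢b c₁ c₂ p∤c₁ combination-zero indep =
    p∤c₁ (subst (+ p ∣_) c-at-a (indep c c-zero a))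
    where
    c : Fin K → ℤ
    c i = c₁ * δ a i + c₂ * δ b i
    c-at-a : c a ≡ c₁
    c-at-a = begin
      c₁ * δ a a + c₂ * δ b a ≡⟨ cong₂ (λ x y → c₁ * x + c₂ * y) (δ-diagonal a) (δ-≢ (≢-sym a≢b)) ⟩
      c₁ * 1ℤ + c₂ * 0ℤ       ≡⟨ solve (c₁ ∷ c₂ ∷ []) ⟩
      c₁                      ∎
    c-zero : ∀ j → ZeroModP p (ΣQ K (λ i → (c i ÷ 1) ℚᵘ.* M (f i) j))
    c-zero j = zeroModP-cong
      (≃-trans (combination≃ f c j) (≃-reflexive (cong (_÷ 2) (sum-pair a b c₁ c₂ (λ i → N (f i) j)))))
      (combination-zero j)

[a/ℕn]*n≡a : ∀ a n .{{_ : ℕ.NonZero n}} → + n ∣ a → (a /ℕ n) * + n ≡ a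
[a/ℕn]*n≡a a n n∣a = begin
  (a /ℕ n) * + n               ≡⟨ ℤ.+-identityˡ ((a /ℕ n) * + n) ⟨
  + 0 + (a /ℕ n) * + n         ≡⟨ cong (λ r → + r + (a /ℕ n) * + n) remainder≡0 ⟨
  + (a %ℕ n) + (a /ℕ n) * + n  ≡⟨ a≡a%ℕn+[a/ℕn]*n a n ⟨
  a                            ∎
  where
  cancel : ∀ r s → r + s - s ≡ r
  cancel = solve-∀ ℤ-ring
  remainder : a - (a /ℕ n) * + n ≡ + (a %ℕ n)
  remainder = trans (cong (_- (a /ℕ n) * + n) (a≡a%ℕn+[a/ℕn]*n a n)) (cancel (+ (a %ℕ n)) ((a /ℕ n) * + n))
  n∣remainder : n ℕ.∣ a %ℕ n
  n∣remainder = Signed.∣⇒∣ᵤ (subst (Signed._∣_ (+ n)) remainder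
    (Signed.∣m∣n⇒∣m-n (Signed.∣ᵤ⇒∣ {+ n} {a} n∣a) (Signed.∣n⇒∣m*n (a /ℕ n) Signed.∣-refl)))
  remainder≡0 : a %ℕ n ≡ 0
  remainder≡0 = trans (sym (ℕ.m<n⇒m%n≡m (n%ℕd<d a n))) (ℕ.n∣m⇒m%n≡0 _ n n∣remainder)

trω-mω-cases : ∀ D → (trω D ≡ 0ℤ × mω D ≡ D) ⊎ (trω D ≡ 1ℤ × + 4 * mω D + 1ℤ ≡ D)
trω-mω-cases D with D≡1mod4 D in D≡1[4]
... | false = inj₁ (refl , refl)
... | true  = inj₂ (refl , (begin
  + 4 * ((D - 1ℤ) divℤ + 4) + 1ℤ  ≡⟨ cong (λ m → + 4 * m + 1ℤ) (div-pos-is-/ℕ (D - 1ℤ) 4) ⟩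
  + 4 * ((D - 1ℤ) /ℕ 4) + 1ℤ      ≡⟨ cong (_+ 1ℤ) (ℤ.*-comm (+ 4) ((D - 1ℤ) /ℕ 4)) ⟩
  (D - 1ℤ) /ℕ 4 * + 4 + 1ℤ        ≡⟨ cong (_+ 1ℤ) ([a/ℕn]*n≡a (D - 1ℤ) 4 4∣D-1) ⟩
  D - 1ℤ + 1ℤ                     ≡⟨ minus-plus D ⟩
  D                               ∎))
  where
  minus-plus : ∀ x → x - 1ℤ + 1ℤ ≡ x
  minus-plus = solve-∀ ℤ-ring
  plus-minus : ∀ x → 1ℤ + x - 1ℤ ≡ x
  plus-minus = solve-∀ ℤ-ring
  D%4≡1 : D %ℕ 4 ≡ 1
  D%4≡1 = ℕ.≡ᵇ⇒≡ (D %ℕ 4) 1 (subst T (sym D≡1[4]) _)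
  4∣D-1 : + 4 ∣ D - 1ℤ
  4∣D-1 = Signed.∣⇒∣ᵤ (Signed.divides (D /ℕ 4) (begin
    D - 1ℤ                          ≡⟨ cong (_- 1ℤ) (a≡a%ℕn+[a/ℕn]*n D 4) ⟩
    + (D %ℕ 4) + (D /ℕ 4) * + 4 - 1ℤ ≡⟨ cong (λ r → + r + (D /ℕ 4) * + 4 - 1ℤ) D%4≡1 ⟩
    1ℤ + (D /ℕ 4) * + 4 - 1ℤ         ≡⟨ plus-minus ((D /ℕ 4) * + 4) ⟩
    (D /ℕ 4) * + 4                   ∎))

∣4m+1⇒∤2 : ∀ {p} → Prime p → ∀ m → + p ∣ + 4 * m + 1ℤ → ¬ (+ p ∣ + 2)
∣4m+1⇒∤2 {p} p-prime m p∣4m+1 p∣2 = prime⇒∤1 p-prime (Signed.∣⇒∣ᵤ (Signed.∣m+n∣m⇒∣n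
  (subst (Signed._∣_ (+ p)) (regroup m) (Signed.∣ᵤ⇒∣ {+ p} {+ 4 * m + 1ℤ} p∣4m+1))
  (Signed.∣m⇒∣m*n (+ 2 * m) (Signed.∣ᵤ⇒∣ {+ p} {+ 2} p∣2))))
  where
  regroup : ∀ m → + 4 * m + 1ℤ ≡ + 2 * (+ 2 * m) + 1ℤ
  regroup = solve-∀ ℤ-ring

module _ (D : ℤ) (p : ℕ) (p-prime : Prime p) (p∣D : + p ∣ D) {n} (G : GQF n) (G-ℤ : ZValued D G) where
  open Forms D
  open Polarisation G
  open RowDependence p (MQ D G) twiceMQ MQ≃twiceMQ/2

  private
    p∤1 : ¬ (+ p ∣ 1ℤ)
    p∤1 = prime⇒∤1 p-prime

    p∣D* : ∀ x → + p ∣ D * x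
    p∣D* x = Signed.∣⇒∣ᵤ (Signed.∣m⇒∣m*n x (Signed.∣ᵤ⇒∣ {+ p} {D} p∣D))

    ℓ : Fin n → Var n → ℤ
    ℓ i j = im (linearPart (basis (i , 0F)) (basis j))

  module _ {K} (f : Fin K → Var n) where

    equal-rows-dependent : ∀ {a b} → a ≢ b → f a ≡ f b → ¬ RowsIndepModP p (MQ D G) f
    equal-rows-dependent {a} {b} a≢b fa≡fb = pair-dependent f a≢b 1ℤ -1ℤ p∤1 λ j →
      zeroModP-half-of-double p-prime 0ℤ (p ℕ.∣0) (begin
        1ℤ * twiceMQ (f a) j + -1ℤ * twiceMQ (f b) j
          ≡⟨ cong (λ k → 1ℤ * twiceMQ (f a) j + -1ℤ * twiceMQ k j) fa≡fb ⟨
        1ℤ * twiceMQ (f a) j + -1ℤ * twiceMQ (f a) j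
          ≡⟨ self-cancel (twiceMQ (f a) j) ⟩
        + 2 * 0ℤ ∎)
      where
      self-cancel : ∀ x → 1ℤ * x + -1ℤ * x ≡ + 2 * 0ℤ
      self-cancel = solve-∀ ℤ-ring

    x-y-rows-dependent : ∀ {a b} → a ≢ b → ∀ {i} → f a ≡ (i , 0F) → f b ≡ (i , 1F) →
      ¬ RowsIndepModP p (MQ D G) f
    x-y-rows-dependent {a} {b} a≢b {i} fa fb with trω-mω-cases D
    ... | inj₁ (t≡0 , m≡D) = pair-dependent f (≢-sym a≢b) 1ℤ 0ℤ p∤1 λ j →
      zeroModP-half-of-double p-prime (D * ℓ i j) (p∣D* (ℓ i j)) (begin
        1ℤ * twiceMQ (f b) j + 0ℤ * twiceMQ (f a) j ≡⟨ first (twiceMQ (f b) j) (twiceMQ (f a) j) ⟩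
        twiceMQ (f b) j                             ≡⟨ cong (λ k → twiceMQ k j) fb ⟩
        twiceMQ (i , 1F) j                          ≡⟨ twiceMQ-y-root G-ℤ i j t≡0 ⟩
        + 2 * (mω D * ℓ i j)                        ≡⟨ cong (λ m → + 2 * (m * ℓ i j)) m≡D ⟩
        + 2 * (D * ℓ i j)                           ∎)
      where
      first : ∀ x y → 1ℤ * x + 0ℤ * y ≡ x
      first = solve-∀ ℤ-ring
    ... | inj₂ (t≡1 , 4m+1≡D) = pair-dependent f (≢-sym a≢b) (+ 2) -1ℤ p∤2 λ j →
      zeroModP-half p∤2 (D * ℓ i j) (p∣D* (ℓ i j)) (begin
        + 2 * twiceMQ (f b) j + -1ℤ * twiceMQ (f a) j ≡⟨ difference (twiceMQ (f b) j) (twiceMQ (f a) j) ⟩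
        + 2 * twiceMQ (f b) j - twiceMQ (f a) j       ≡⟨ cong₂ (λ k k′ → + 2 * twiceMQ k j - twiceMQ k′ j) fb fa ⟩
        + 2 * twiceMQ (i , 1F) j - twiceMQ (i , 0F) j ≡⟨ twiceMQ-y-half G-ℤ i j t≡1 ⟩
        (+ 4 * mω D + 1ℤ) * ℓ i j                     ≡⟨ cong (_* ℓ i j) 4m+1≡D ⟩
        D * ℓ i j                                     ∎)
      where
      difference : ∀ x y → + 2 * x + -1ℤ * y ≡ + 2 * x - y
      difference = solve-∀ ℤ-ring
      p∤2 : ¬ (+ p ∣ + 2)
      p∤2 = ∣4m+1⇒∤2 p-prime (mω D) (subst (+ p ∣_) (sym 4m+1≡D) p∣D)

    same-variable-dependent : ∀ {a b} → a ≢ b → ∀ k l → f a ≡ k → f b ≡ l → proj₁ k ≡ proj₁ l →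
      ¬ RowsIndepModP p (MQ D G) f
    same-variable-dependent a≢b (i , 0F) (.i , 0F) fa fb refl = equal-rows-dependent a≢b (trans fa (sym fb))
    same-variable-dependent a≢b (i , 1F) (.i , 1F) fa fb refl = equal-rows-dependent a≢b (trans fa (sym fb))
    same-variable-dependent a≢b (i , 0F) (.i , 1F) fa fb refl = x-y-rows-dependent a≢b fa fb
    same-variable-dependent a≢b (i , 1F) (.i , 0F) fa fb refl = x-y-rows-dependent (≢-sym a≢b) fb fa

  rank≤n : RankModP≤ p (MQ D G) n
  rank≤n K f indep = ℕ.≮⇒≥ λ n<K →
    let a , b , a<b , same-variable = Fin.pigeonhole n<K (λ i → proj₁ (f i))
    in same-variable-dependent f (Fin.<⇒≢ a<b) (f a) (f b) refl refl same-variable indep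

proposition4p7 : (D : ℤ) → D ≢ 0ℤ → D ≢ 1ℤ → SquareFree D →
    (p : ℕ) → Prime p → (+ p) ∣ D →
    (n : ℕ) (G : GQF n) → ZValued D G →
    RankModP≤ p (MQ D G) n
proposition4p7 D _ _ _ p p-prime p∣D n G G-ℤ = rank≤n D p p-prime p∣D G G-ℤ
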